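{- For all integers $n\geq 1$ and $p\geq 1$ and every real $y$, \[ p^{2}\sum_{k=1}^{n}\binom{n+1}{k+1}y^{n-k}B_{k,p}=(p+1)\,y^{n+1}+p\,(n+1)\,y^{n}-(p+1)\,B_{n+1,p-1}(1+y). \]
   Context: For each integer $q\geq 0$, the $q$-Bernoulli numbers $B_{n,q}$ are defined by $B_{0,q}=1$ and $B_{n+1,q}=qB_{n,q}-\frac{(q+1)^{2}}{q+2}B_{n,q+1}$ ($n,q\ge 0$), and the $q$-Bernoulli polynomials by $B_{n,q}(x)=\sum_{k=0}^{n}\binom{n}{k}x^{n-k}B_{k,q}$.
   Formalization: The variable y ranges over the rationals instead of the reals. -}

module Defs where

open import Data.Nat as ℕ using (ℕ; zero; suc; _∸_)
open import Data.Nat.Combinatorics using (_C_)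
open import Data.Integer using (+_)
open import Data.Rational using (ℚ; 0ℚ; 1ℚ; _+_; _-_; _*_; _/_)
open import Data.List using (List; map; foldr; upTo)

ℕ→ℚ : ℕ → ℚ
ℕ→ℚ n = + n / 1

infixr 8 _^_
_^_ : ℚ → ℕ → ℚ
x ^ zero  = 1ℚ
x ^ suc n = x * x ^ n

sumℚ : List ℚ → ℚ
sumℚ = foldr _+_ 0ℚ

-- Σ_{k=a}^{b} f k  (empty if b < a)
Σ[_⋯_] : ℕ → ℕ → (ℕ → ℚ) → ℚ
Σ[ a ⋯ b ] f = sumℚ (map (λ i → f (a ℕ.+ i)) (upTo (suc b ∸ a)))

-- q-Bernoulli numbers: B n q = B_{n,q}
--   B_{0,q} = 1,  B_{n+1,q} = q B_{n,q} - (q+1)^2/(q+2) B_{n,q+1}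
B : ℕ → ℕ → ℚ
B zero    q = 1ℚ
B (suc n) q = ℕ→ℚ q * B n q - ((+ ((suc q) ℕ.* (suc q))) / (suc (suc q))) * B n (suc q)

Bpoly : ℕ → ℕ → ℚ → ℚ
Bpoly n q x = Σ[ 0 ⋯ n ] (λ k → ℕ→ℚ (n C k) * x ^ (n ∸ k) * B k q)

{-# OPTIONS --safe #-}
-- Write P_{q,m}(x) = B_{m,q}(x), Q_{q,m}(x) = Σ_{k=1}^{m} C(m,k) x^{m-k} B_{k-1,q} and
-- γ_q = (q+1)²/(q+2).  The recurrence defining B_{k,q} gives, term by term,
--   P_{q,m}(y) = y^m + q Q_{q,m}(y) - γ_q Q_{q+1,m}(y),
-- and together with Pascal's rule the recurrence
--   P_{q,m+1}(x) = (x + q) P_{q,m}(x) - γ_q P_{q+1,m}(x).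
-- Induction on m, for all q at once and using γ_q (q+2) = (q+1)², yields the shift formula
--   P_{q,m}(1+y) = P_{q,m}(y) + (q+1) m y^{m-1} - q Q_{q,m}(y),
-- hence P_{q,m}(1+y) = y^m + (q+1) m y^{m-1} - γ_q Q_{q+1,m}(y).  For q = p-1 and m = n+1,
-- multiplying by p+1 and splitting off the k = 1 term of Q_{p,n+1}(y) gives the proposition.
module Submission where

open import Defs
open import Function using (_∘_; id)
open import Data.Nat as ℕ using (ℕ; zero; suc; _≤_; _∸_)
import Data.Nat.Properties as ℕ
open import Data.Nat.Combinatorics using (_C_; nCk+nC[k+1]≡[n+1]C[k+1]; nC1≡n; k>n⇒nCk≡0)
open import Data.Fin using (Fin; toℕ; fromℕ; inject₁)
open import Data.Fin.Properties using (toℕ<n; toℕ-fromℕ; toℕ-inject₁)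
open import Data.Integer as ℤ using (+_)
import Data.Integer.Properties as ℤ
open import Data.List using (map; applyUpTo; _∷_; [])
open import Data.Rational using (ℚ; 0ℚ; 1ℚ; _+_; _-_; _*_; -_; _/_; toℚᵘ)
open import Data.Rational.Properties
  using (_≟_; +-*-commutativeRing; *-zeroˡ; *-identityˡ; +-identityʳ; neg-distribˡ-*;
         toℚᵘ-injective; toℚᵘ-fromℚᵘ; toℚᵘ-homo-+; toℚᵘ-homo-*)
import Data.Rational.Unnormalised as ℚᵘ
import Data.Rational.Unnormalised.Properties as ℚᵘ
open import Algebra.Bundles using (CommutativeRing)
open import Algebra.Properties.Semiring.Sum (CommutativeRing.semiring +-*-commutativeRing)
  using (sum-syntax; sum-cong-≗; sum-init-last; ∑-distrib-+; *-distribˡ-sum)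
open import Level using (0ℓ)
open import Relation.Binary.PropositionalEquality
open import Relation.Nullary.Decidable using (dec⇒maybe)
open import Tactic.RingSolver using (solve-∀; solve)
import Tactic.RingSolver.Core.AlmostCommutativeRing as ACR

ℚ-ring : ACR.AlmostCommutativeRing 0ℓ 0ℓ
ℚ-ring = ACR.fromCommutativeRing +-*-commutativeRing (λ x → dec⇒maybe (0ℚ ≟ x))

-- Lets the ring solver use a relation a ≡ b: it only has to prove the identity
-- with an explicit multiple of b - a added.
≡-modulo : ∀ {lhs rhs} k {a b} → a ≡ b → lhs ≡ rhs + k * (b - a) → lhs ≡ rhs
≡-modulo {rhs = rhs} k {a} refl lhs≡ = trans lhs≡ (cancel rhs k a)
  where
  cancel : ∀ r k a → r + k * (a - a) ≡ r
  cancel = solve-∀ ℚ-ring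

toℚᵘ-/ : ∀ m d → toℚᵘ (+ m / suc d) ℚᵘ.≃ ℚᵘ.mkℚᵘ (+ m) d
toℚᵘ-/ m d = toℚᵘ-fromℚᵘ (ℚᵘ.mkℚᵘ (+ m) d)

ℕ→ℚ-homo-+ : ∀ m n → ℕ→ℚ (m ℕ.+ n) ≡ ℕ→ℚ m + ℕ→ℚ n
ℕ→ℚ-homo-+ m n = toℚᵘ-injective (begin
  toℚᵘ (ℕ→ℚ (m ℕ.+ n))                  ≈⟨ toℚᵘ-/ (m ℕ.+ n) 0 ⟩
  ℚᵘ.mkℚᵘ (+ (m ℕ.+ n)) 0                ≈⟨ ℚᵘ.*≡* (cong (ℤ._* + 1) numerators) ⟩
  ℚᵘ.mkℚᵘ (+ m) 0 ℚᵘ.+ ℚᵘ.mkℚᵘ (+ n) 0   ≈⟨ ℚᵘ.+-cong (toℚᵘ-/ m 0) (toℚᵘ-/ n 0) ⟨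
  toℚᵘ (ℕ→ℚ m) ℚᵘ.+ toℚᵘ (ℕ→ℚ n)         ≈⟨ toℚᵘ-homo-+ (ℕ→ℚ m) (ℕ→ℚ n) ⟨
  toℚᵘ (ℕ→ℚ m + ℕ→ℚ n)                  ∎)
  where
  open ℚᵘ.≃-Reasoning
  numerators : + (m ℕ.+ n) ≡ + m ℤ.* + 1 ℤ.+ + n ℤ.* + 1
  numerators = trans (ℤ.pos-+ m n) (sym (cong₂ ℤ._+_ (ℤ.*-identityʳ (+ m)) (ℤ.*-identityʳ (+ n))))

ℕ→ℚ-homo-* : ∀ m n → ℕ→ℚ (m ℕ.* n) ≡ ℕ→ℚ m * ℕ→ℚ n
ℕ→ℚ-homo-* m n = toℚᵘ-injective (begin
  toℚᵘ (ℕ→ℚ (m ℕ.* n))                  ≈⟨ toℚᵘ-/ (m ℕ.* n) 0 ⟩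
  ℚᵘ.mkℚᵘ (+ (m ℕ.* n)) 0                ≈⟨ ℚᵘ.*≡* (cong (ℤ._* + 1) (ℤ.pos-* m n)) ⟩
  ℚᵘ.mkℚᵘ (+ m) 0 ℚᵘ.* ℚᵘ.mkℚᵘ (+ n) 0   ≈⟨ ℚᵘ.*-cong (toℚᵘ-/ m 0) (toℚᵘ-/ n 0) ⟨
  toℚᵘ (ℕ→ℚ m) ℚᵘ.* toℚᵘ (ℕ→ℚ n)         ≈⟨ toℚᵘ-homo-* (ℕ→ℚ m) (ℕ→ℚ n) ⟨
  toℚᵘ (ℕ→ℚ m * ℕ→ℚ n)                  ∎)
  where open ℚᵘ.≃-Reasoning

m/d*d≡m : ∀ m d → (+ m / suc d) * ℕ→ℚ (suc d) ≡ ℕ→ℚ m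
m/d*d≡m m d = toℚᵘ-injective (begin
  toℚᵘ ((+ m / suc d) * ℕ→ℚ (suc d))           ≈⟨ toℚᵘ-homo-* (+ m / suc d) (ℕ→ℚ (suc d)) ⟩
  toℚᵘ (+ m / suc d) ℚᵘ.* toℚᵘ (ℕ→ℚ (suc d))  ≈⟨ ℚᵘ.*-cong (toℚᵘ-/ m d) (toℚᵘ-/ (suc d) 0) ⟩
  ℚᵘ.mkℚᵘ (+ m) d ℚᵘ.* ℚᵘ.mkℚᵘ (+ suc d) 0     ≈⟨ ℚᵘ.*≡* cross ⟩
  ℚᵘ.mkℚᵘ (+ m) 0                              ≈⟨ toℚᵘ-/ m 0 ⟨
  toℚᵘ (ℕ→ℚ m)                                 ∎)
  where
  open ℚᵘ.≃-Reasoning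
  cross : (+ m ℤ.* + suc d) ℤ.* + 1 ≡ + m ℤ.* + (suc d ℕ.* 1)
  cross = trans (ℤ.*-identityʳ _) (cong (λ k → + m ℤ.* + k) (sym (ℕ.*-identityʳ (suc d))))

sumℚ-applyUpTo : ∀ (g : ℕ → ℚ) h n → sumℚ (map g (applyUpTo h n)) ≡ ∑[ i < n ] g (h (toℕ i))
sumℚ-applyUpTo g h zero    = refl
sumℚ-applyUpTo g h (suc n) = cong (λ s → g (h 0) + s) (sumℚ-applyUpTo g (h ∘ suc) n)

Σ⋯≡∑ : ∀ a b f → Σ[ a ⋯ b ] f ≡ ∑[ i < suc b ∸ a ] f (a ℕ.+ toℕ i)
Σ⋯≡∑ a b f = sumℚ-applyUpTo (λ i → f (a ℕ.+ i)) id (suc b ∸ a)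

∑-lincomb : ∀ {n} α β (w a b : Fin n → ℚ) →
  ∑[ i < n ] (w i * (α * a i - β * b i))
    ≡ α * ∑[ i < n ] (w i * a i) - β * ∑[ i < n ] (w i * b i)
∑-lincomb {n} α β w a b = begin
  ∑[ i < n ] (w i * (α * a i - β * b i))
    ≡⟨ sum-cong-≗ (λ i → distribute α β (w i) (a i) (b i)) ⟩
  ∑[ i < n ] (α * (w i * a i) + - β * (w i * b i))
    ≡⟨ ∑-distrib-+ (λ i → α * (w i * a i)) (λ i → - β * (w i * b i)) ⟩
  ∑[ i < n ] (α * (w i * a i)) + ∑[ i < n ] (- β * (w i * b i))
    ≡⟨ cong₂ _+_ (*-distribˡ-sum α (λ i → w i * a i)) (*-distribˡ-sum (- β) (λ i → w i * b i)) ⟨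
  α * ∑[ i < n ] (w i * a i) + - β * ∑[ i < n ] (w i * b i)
    ≡⟨ cong (λ t → α * ∑[ i < n ] (w i * a i) + t) (neg-distribˡ-* β _) ⟨
  α * ∑[ i < n ] (w i * a i) - β * ∑[ i < n ] (w i * b i)
    ∎
  where
  open ≡-Reasoning
  distribute : ∀ α β w a b → w * (α * a - β * b) ≡ α * (w * a) + - β * (w * b)
  distribute = solve-∀ ℚ-ring

appell : (ℕ → ℚ) → ℕ → ℚ → ℚ
appell a m x = ∑[ k < suc m ] (ℕ→ℚ (m C toℕ k) * x ^ (m ∸ toℕ k) * a (toℕ k))

appell-suc : ∀ a m x → appell a (suc m) x ≡ x * appell a m x + appell (a ∘ suc) m x
appell-suc a m x = begin
  appell a (suc m) x
    ≡⟨⟩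
  1ℚ * x ^ suc m * a 0 + ∑[ i < suc m ] (ℕ→ℚ (suc m C suc (toℕ i)) * x ^ (m ∸ toℕ i) * a (suc (toℕ i)))
    ≡⟨ cong (λ t → 1ℚ * x ^ suc m * a 0 + t) (trans (sum-cong-≗ {suc m} (pascal ∘ toℕ))
                                                     (∑-distrib-+ {suc m} (same ∘ toℕ) (upper ∘ toℕ))) ⟩
  1ℚ * x ^ suc m * a 0 + (appell (a ∘ suc) m x + ∑[ i < suc m ] upper (toℕ i))
    ≡⟨ cong (λ t → 1ℚ * x ^ suc m * a 0 + (appell (a ∘ suc) m x + t)) ∑upper ⟩
  1ℚ * x ^ suc m * a 0 + (appell (a ∘ suc) m x + x * ∑[ i < m ] lower (toℕ i))
    ≡⟨ regroup x (x ^ m) (a 0) (appell (a ∘ suc) m x) (∑[ i < m ] lower (toℕ i)) ⟩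
  x * (1ℚ * x ^ m * a 0 + ∑[ i < m ] lower (toℕ i)) + appell (a ∘ suc) m x
    ∎
  where
  open ≡-Reasoning
  same upper lower : ℕ → ℚ
  same  j = ℕ→ℚ (m C j) * x ^ (m ∸ j) * a (suc j)
  upper j = ℕ→ℚ (m C suc j) * x ^ (m ∸ j) * a (suc j)
  lower j = ℕ→ℚ (m C suc j) * x ^ (m ∸ suc j) * a (suc j)

  pascal : ∀ j → ℕ→ℚ (suc m C suc j) * x ^ (m ∸ j) * a (suc j) ≡ same j + upper j
  pascal j = begin
    ℕ→ℚ (suc m C suc j) * x ^ (m ∸ j) * a (suc j)
      ≡⟨ cong (λ c → ℕ→ℚ c * x ^ (m ∸ j) * a (suc j)) (nCk+nC[k+1]≡[n+1]C[k+1] m j) ⟨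
    ℕ→ℚ (m C j ℕ.+ m C suc j) * x ^ (m ∸ j) * a (suc j)
      ≡⟨ cong (λ c → c * x ^ (m ∸ j) * a (suc j)) (ℕ→ℚ-homo-+ (m C j) (m C suc j)) ⟩
    (ℕ→ℚ (m C j) + ℕ→ℚ (m C suc j)) * x ^ (m ∸ j) * a (suc j)
      ≡⟨ split (ℕ→ℚ (m C j)) (ℕ→ℚ (m C suc j)) (x ^ (m ∸ j)) (a (suc j)) ⟩
    same j + upper j
      ∎
    where
    split : ∀ c c′ p b → (c + c′) * p * b ≡ c * p * b + c′ * p * b
    split = solve-∀ ℚ-ring

  upper≡x*lower : ∀ j → j ℕ.< m → upper j ≡ x * lower j
  upper≡x*lower j j<m = begin
    ℕ→ℚ (m C suc j) * x ^ (m ∸ j) * a (suc j)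
      ≡⟨ cong (λ e → ℕ→ℚ (m C suc j) * x ^ e * a (suc j)) (ℕ.+-∸-assoc 1 j<m) ⟩
    ℕ→ℚ (m C suc j) * (x * x ^ (m ∸ suc j)) * a (suc j)
      ≡⟨ shuffle x (ℕ→ℚ (m C suc j)) (x ^ (m ∸ suc j)) (a (suc j)) ⟩
    x * lower j
      ∎
    where
    shuffle : ∀ x c p b → c * (x * p) * b ≡ x * (c * p * b)
    shuffle = solve-∀ ℚ-ring

  upper-top : upper m ≡ 0ℚ
  upper-top = begin
    ℕ→ℚ (m C suc m) * x ^ (m ∸ m) * a (suc m)
      ≡⟨ cong (λ c → ℕ→ℚ c * x ^ (m ∸ m) * a (suc m)) (k>n⇒nCk≡0 (ℕ.n<1+n m)) ⟩
    0ℚ * x ^ (m ∸ m) * a (suc m)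
      ≡⟨ trans (cong (_* a (suc m)) (*-zeroˡ (x ^ (m ∸ m)))) (*-zeroˡ (a (suc m))) ⟩
    0ℚ
      ∎

  ∑upper : ∑[ i < suc m ] upper (toℕ i) ≡ x * ∑[ i < m ] lower (toℕ i)
  ∑upper = begin
    ∑[ i < suc m ] upper (toℕ i)
      ≡⟨ sum-init-last {m} (upper ∘ toℕ) ⟩
    ∑[ i < m ] upper (toℕ (inject₁ i)) + upper (toℕ (fromℕ m))
      ≡⟨ cong₂ _+_ (sum-cong-≗ {m} λ i → trans (cong upper (toℕ-inject₁ i)) (upper≡x*lower (toℕ i) (toℕ<n i)))
                   (trans (cong upper (toℕ-fromℕ m)) upper-top) ⟩
    ∑[ i < m ] (x * lower (toℕ i)) + 0ℚ
      ≡⟨ +-identityʳ (∑[ i < m ] (x * lower (toℕ i))) ⟩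
    ∑[ i < m ] (x * lower (toℕ i))
      ≡⟨ *-distribˡ-sum {m} x (lower ∘ toℕ) ⟨
    x * ∑[ i < m ] lower (toℕ i)
      ∎

  regroup : ∀ x p a₀ s t → 1ℚ * (x * p) * a₀ + (s + x * t) ≡ x * (1ℚ * p * a₀ + t) + s
  regroup = solve-∀ ℚ-ring

infixr 5 _◅_
_◅_ : ℚ → (ℕ → ℚ) → ℕ → ℚ
(c ◅ a) zero    = c
(c ◅ a) (suc k) = a k

appell-◅ : ∀ c α β a b m x →
  appell (c ◅ λ k → α * a k - β * b k) m x
    ≡ c * x ^ m + α * appell (0ℚ ◅ a) m x - β * appell (0ℚ ◅ b) m x
appell-◅ c α β a b m x = begin
  1ℚ * x ^ m * c + ∑[ i < m ] (w (toℕ i) * (α * a (toℕ i) - β * b (toℕ i)))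
    ≡⟨ cong (λ t → 1ℚ * x ^ m * c + t) (∑-lincomb {m} α β (w ∘ toℕ) (a ∘ toℕ) (b ∘ toℕ)) ⟩
  1ℚ * x ^ m * c + (α * ∑a - β * ∑b)
    ≡⟨ regroup (x ^ m) c α β ∑a ∑b ⟩
  c * x ^ m + α * (1ℚ * x ^ m * 0ℚ + ∑a) - β * (1ℚ * x ^ m * 0ℚ + ∑b)
    ∎
  where
  open ≡-Reasoning
  w : ℕ → ℚ
  w j = ℕ→ℚ (m C suc j) * x ^ (m ∸ suc j)
  ∑a ∑b : ℚ
  ∑a = ∑[ i < m ] (w (toℕ i) * a (toℕ i))
  ∑b = ∑[ i < m ] (w (toℕ i) * b (toℕ i))
  regroup : ∀ p c α β s t →
    1ℚ * p * c + (α * s - β * t) ≡ c * p + α * (1ℚ * p * 0ℚ + s) - β * (1ℚ * p * 0ℚ + t)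
  regroup = solve-∀ ℚ-ring

Bseq : ℕ → ℕ → ℚ
Bseq q k = B k q

γ : ℕ → ℚ
γ q = + (suc q ℕ.* suc q) / suc (suc q)

γ*[2+q]≡[1+q]² : ∀ q → γ q * ℕ→ℚ (suc (suc q)) ≡ ℕ→ℚ (suc q) * ℕ→ℚ (suc q)
γ*[2+q]≡[1+q]² q = trans (m/d*d≡m (suc q ℕ.* suc q) (suc q)) (ℕ→ℚ-homo-* (suc q) (suc q))

Qpoly : ℕ → ℕ → ℚ → ℚ
Qpoly m q x = appell (0ℚ ◅ Bseq q) m x

Bpoly≡appell : ∀ m q x → Bpoly m q x ≡ appell (Bseq q) m x
Bpoly≡appell m q x = Σ⋯≡∑ 0 m (λ k → ℕ→ℚ (m C k) * x ^ (m ∸ k) * B k q)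

Bpoly-unfold : ∀ m q y → Bpoly m q y ≡ y ^ m + ℕ→ℚ q * Qpoly m q y - γ q * Qpoly m (suc q) y
Bpoly-unfold m q y = begin
  Bpoly m q y
    ≡⟨ Bpoly≡appell m q y ⟩
  -- Bseq q and this sequence agree definitionally at every index.
  appell (1ℚ ◅ λ k → ℕ→ℚ q * B k q - γ q * B k (suc q)) m y
    ≡⟨ appell-◅ 1ℚ (ℕ→ℚ q) (γ q) (Bseq q) (Bseq (suc q)) m y ⟩
  1ℚ * y ^ m + ℕ→ℚ q * Qpoly m q y - γ q * Qpoly m (suc q) y
    ≡⟨ cong (λ t → t + ℕ→ℚ q * Qpoly m q y - γ q * Qpoly m (suc q) y) (*-identityˡ (y ^ m)) ⟩
  y ^ m + ℕ→ℚ q * Qpoly m q y - γ q * Qpoly m (suc q) y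
    ∎
  where open ≡-Reasoning

Bpoly-suc : ∀ m q x → Bpoly (suc m) q x ≡ (x + ℕ→ℚ q) * Bpoly m q x - γ q * Bpoly m (suc q) x
Bpoly-suc m q x = begin
  Bpoly (suc m) q x
    ≡⟨ Bpoly≡appell (suc m) q x ⟩
  appell (Bseq q) (suc m) x
    ≡⟨ appell-suc (Bseq q) m x ⟩
  x * A + appell (λ k → ℕ→ℚ q * B k q - γ q * B k (suc q)) m x
    ≡⟨ cong (λ t → x * A + t) (∑-lincomb {suc m} (ℕ→ℚ q) (γ q) (λ i → ℕ→ℚ (m C toℕ i) * x ^ (m ∸ toℕ i))
                                          (Bseq q ∘ toℕ) (Bseq (suc q) ∘ toℕ)) ⟩
  x * A + (ℕ→ℚ q * A - γ q * A′)
    ≡⟨ regroup x (ℕ→ℚ q) (γ q) A A′ ⟩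
  (x + ℕ→ℚ q) * A - γ q * A′
    ≡⟨ cong₂ (λ s t → (x + ℕ→ℚ q) * s - γ q * t) (Bpoly≡appell m q x) (Bpoly≡appell m (suc q) x) ⟨
  (x + ℕ→ℚ q) * Bpoly m q x - γ q * Bpoly m (suc q) x
    ∎
  where
  open ≡-Reasoning
  A A′ : ℚ
  A  = appell (Bseq q) m x
  A′ = appell (Bseq (suc q)) m x
  regroup : ∀ x u c a a′ → x * a + (u * a - c * a′) ≡ (x + u) * a - c * a′
  regroup = solve-∀ ℚ-ring

Qpoly-suc : ∀ m q x → Qpoly (suc m) q x ≡ x * Qpoly m q x + Bpoly m q x
Qpoly-suc m q x =
  trans (appell-suc (0ℚ ◅ Bseq q) m x) (cong (λ t → x * Qpoly m q x + t) (sym (Bpoly≡appell m q x)))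

Qpoly-suc≡Σ : ∀ n q y →
  Qpoly (suc n) q y ≡ ℕ→ℚ (suc n) * y ^ n + Σ[ 1 ⋯ n ] (λ k → ℕ→ℚ (suc n C suc k) * y ^ (n ∸ k) * B k q)
Qpoly-suc≡Σ n q y = begin
  1ℚ * y ^ suc n * 0ℚ + (ℕ→ℚ (suc n C 1) * y ^ n * 1ℚ + ∑[ i < n ] f (suc (toℕ i)))
    ≡⟨ cong₂ (λ c t → 1ℚ * y ^ suc n * 0ℚ + (ℕ→ℚ c * y ^ n * 1ℚ + t)) (nC1≡n (suc n)) (sym (Σ⋯≡∑ 1 n f)) ⟩
  1ℚ * y ^ suc n * 0ℚ + (ℕ→ℚ (suc n) * y ^ n * 1ℚ + Σ[ 1 ⋯ n ] f)
    ≡⟨ simplify (y ^ suc n) (ℕ→ℚ (suc n) * y ^ n) (Σ[ 1 ⋯ n ] f) ⟩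
  ℕ→ℚ (suc n) * y ^ n + Σ[ 1 ⋯ n ] f
    ∎
  where
  open ≡-Reasoning
  f : ℕ → ℚ
  f k = ℕ→ℚ (suc n C suc k) * y ^ (n ∸ k) * B k q
  simplify : ∀ p a s → 1ℚ * p * 0ℚ + (a * 1ℚ + s) ≡ a + s
  simplify = solve-∀ ℚ-ring

-- The derivative of y ^ m; the truncated m ∸ 1 is harmless at m = 0, where the coefficient is 0.
pow′ : ℕ → ℚ → ℚ
pow′ m y = ℕ→ℚ m * y ^ (m ∸ 1)

pow′-suc : ∀ m y → pow′ (suc m) y ≡ y * pow′ m y + y ^ m
pow′-suc zero    y = base y
  where
  base : ∀ y → 1ℚ * 1ℚ ≡ y * (0ℚ * 1ℚ) + 1ℚ
  base = solve-∀ ℚ-ring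
pow′-suc (suc m) y = begin
  ℕ→ℚ (suc (suc m)) * (y * y ^ m)
    ≡⟨ cong (λ c → c * (y * y ^ m)) (ℕ→ℚ-homo-+ 1 (suc m)) ⟩
  (1ℚ + ℕ→ℚ (suc m)) * (y * y ^ m)
    ≡⟨ leibniz (ℕ→ℚ (suc m)) y (y ^ m) ⟩
  y * (ℕ→ℚ (suc m) * y ^ m) + y * y ^ m
    ∎
  where
  open ≡-Reasoning
  leibniz : ∀ c y p → (1ℚ + c) * (y * p) ≡ y * (c * p) + y * p
  leibniz = solve-∀ ℚ-ring

Bpoly-shift-step : ∀ y u c P′ Q Q′ D yᵐ {u₁ u₂ P} →
  u₁ ≡ 1ℚ + u → u₂ ≡ 1ℚ + u₁ → c * u₂ ≡ u₁ * u₁ → P ≡ yᵐ + u * Q - c * Q′ →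
  (1ℚ + y + u) * (P + u₁ * D - u * Q) - c * (P′ + u₂ * D - u₁ * Q′)
    ≡ ((y + u) * P - c * P′) + u₁ * (y * D + yᵐ) - u * (y * Q + P)
Bpoly-shift-step y u c P′ Q Q′ D yᵐ refl refl cu₂≡u₁² refl =
  ≡-modulo D cu₂≡u₁² (solve (y ∷ u ∷ c ∷ P′ ∷ Q ∷ Q′ ∷ D ∷ yᵐ ∷ []) ℚ-ring)

Bpoly-shift : ∀ m q y →
  Bpoly m q (1ℚ + y) ≡ Bpoly m q y + ℕ→ℚ (suc q) * pow′ m y - ℕ→ℚ q * Qpoly m q y
Bpoly-shift zero    q y = base (ℕ→ℚ (suc q)) (ℕ→ℚ q)
  where
  base : ∀ u₁ u → 1ℚ ≡ 1ℚ + u₁ * 0ℚ - u * 0ℚ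
  base = solve-∀ ℚ-ring
Bpoly-shift (suc m) q y = begin
  Bpoly (suc m) q (1ℚ + y)
    ≡⟨ Bpoly-suc m q (1ℚ + y) ⟩
  (1ℚ + y + u) * Bpoly m q (1ℚ + y) - γ q * Bpoly m (suc q) (1ℚ + y)
    ≡⟨ cong₂ (λ s t → (1ℚ + y + u) * s - γ q * t) (Bpoly-shift m q y) (Bpoly-shift m (suc q) y) ⟩
  (1ℚ + y + u) * (P + u₁ * D - u * Q) - γ q * (P′ + u₂ * D - u₁ * Q′)
    ≡⟨ Bpoly-shift-step y u (γ q) P′ Q Q′ D (y ^ m)
         (ℕ→ℚ-homo-+ 1 q) (ℕ→ℚ-homo-+ 1 (suc q)) (γ*[2+q]≡[1+q]² q) (Bpoly-unfold m q y) ⟩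
  ((y + u) * P - γ q * P′) + u₁ * (y * D + y ^ m) - u * (y * Q + P)
    ≡⟨ cong₂ (λ s t → s + u₁ * (y * D + y ^ m) - u * t) (Bpoly-suc m q y) (Qpoly-suc m q y) ⟨
  Bpoly (suc m) q y + u₁ * (y * D + y ^ m) - u * Qpoly (suc m) q y
    ≡⟨ cong (λ d → Bpoly (suc m) q y + u₁ * d - u * Qpoly (suc m) q y) (pow′-suc m y) ⟨
  Bpoly (suc m) q y + u₁ * pow′ (suc m) y - u * Qpoly (suc m) q y
    ∎
  where
  open ≡-Reasoning
  u u₁ u₂ P P′ Q Q′ D : ℚ
  u  = ℕ→ℚ q
  u₁ = ℕ→ℚ (suc q)
  u₂ = ℕ→ℚ (suc (suc q))
  P  = Bpoly m q y
  P′ = Bpoly m (suc q) y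
  Q  = Qpoly m q y
  Q′ = Qpoly m (suc q) y
  D  = pow′ m y

Bpoly-shift′ : ∀ m q y →
  Bpoly m q (1ℚ + y) ≡ y ^ m + ℕ→ℚ (suc q) * pow′ m y - γ q * Qpoly m (suc q) y
Bpoly-shift′ m q y = begin
  Bpoly m q (1ℚ + y)
    ≡⟨ Bpoly-shift m q y ⟩
  Bpoly m q y + ℕ→ℚ (suc q) * pow′ m y - ℕ→ℚ q * Qpoly m q y
    ≡⟨ cong (λ t → t + ℕ→ℚ (suc q) * pow′ m y - ℕ→ℚ q * Qpoly m q y) (Bpoly-unfold m q y) ⟩
  y ^ m + ℕ→ℚ q * Qpoly m q y - γ q * Qpoly m (suc q) y + ℕ→ℚ (suc q) * pow′ m y - ℕ→ℚ q * Qpoly m q y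
    ≡⟨ cancel (y ^ m) (ℕ→ℚ q * Qpoly m q y) (γ q * Qpoly m (suc q) y) (ℕ→ℚ (suc q) * pow′ m y) ⟩
  y ^ m + ℕ→ℚ (suc q) * pow′ m y - γ q * Qpoly m (suc q) y
    ∎
  where
  open ≡-Reasoning
  cancel : ∀ a b c d → a + b - c + d - b ≡ a + d - c
  cancel = solve-∀ ℚ-ring

closing-identity : ∀ p c N yⁿ {p₁ p² P₁ yⁿ⁺¹ Q s} →
  p₁ ≡ 1ℚ + p → p² ≡ p * p → c * p₁ ≡ p * p →
  P₁ ≡ yⁿ⁺¹ + p * (N * yⁿ) - c * Q → Q ≡ N * yⁿ + s →
  p² * s ≡ p₁ * yⁿ⁺¹ + p * N * yⁿ - p₁ * P₁
closing-identity p c N yⁿ {yⁿ⁺¹ = yⁿ⁺¹} {s = s} refl refl cp₁≡p² refl refl =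
  ≡-modulo (N * yⁿ + s) cp₁≡p² (solve (p ∷ c ∷ N ∷ yⁿ ∷ yⁿ⁺¹ ∷ s ∷ []) ℚ-ring)

proposition3 : (n p : ℕ) → 1 ≤ n → 1 ≤ p → (y : ℚ) →
    ℕ→ℚ (p ℕ.* p) * Σ[ 1 ⋯ n ] (λ k → ℕ→ℚ (suc n C suc k) * y ^ (n ∸ k) * B k p)
      ≡ ℕ→ℚ (suc p) * y ^ suc n + ℕ→ℚ p * ℕ→ℚ (suc n) * y ^ n
        - ℕ→ℚ (suc p) * Bpoly (suc n) (p ∸ 1) (1ℚ + y)
proposition3 n (suc q) _ _ y =
  closing-identity (ℕ→ℚ (suc q)) (γ q) (ℕ→ℚ (suc n)) (y ^ n)
    (ℕ→ℚ-homo-+ 1 (suc q)) (ℕ→ℚ-homo-* (suc q) (suc q)) (γ*[2+q]≡[1+q]² q)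
    (Bpoly-shift′ (suc n) q y) (Qpoly-suc≡Σ n (suc q) y)
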